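{- If $G$ is the block intersection graph of a balanced incomplete block design with parameters $(v,k,1)$, then $z(G)\le k$.
   Context: A balanced incomplete block design with parameters $(v,k,\lambda)$ is a set $V$ of $v$ points with a collection of $k$-element subsets (blocks) such that every pair of distinct points lies in exactly $\lambda$ blocks; its block intersection graph has the blocks as vertices, two blocks adjacent iff they intersect. Deterministic Zombies and Survivors: zombies are placed first, then the survivor; players alternate turns, zombies first; the survivor moves to an adjacent vertex or stays still; each zombie must move on every turn to a neighbor strictly closer (in graph distance) to the survivor, zombies coordinating among such moves; zombies win if a zombie occupies the survivor's vertex. The zombie number $z(G)$ is the minimum number of zombies guaranteeing a win. -}

module Defs where

open import Level using (Level; _⊔_) renaming (suc to lsuc)
open import Data.Nat using (ℕ; zero; suc; _≤_; _<_)
open import Data.Fin using (Fin)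
open import Data.Fin.Subset using (Subset; _∈_; ∣_∣)
open import Data.Product using (Σ; ∃; ∃-syntax; _×_; _,_)
open import Data.Sum using (_⊎_)
open import Relation.Binary.PropositionalEquality using (_≡_; _≢_)

-- Balanced incomplete block designs with λ = 1.
-- Points are Fin v; the design has b blocks (indexed by Fin b, so
-- repeated blocks would be allowed in principle), each a k-subset.

record BIBD₁ (v k : ℕ) : Set where
  field
    b       : ℕ
    block   : Fin b → Subset v
    size    : ∀ i → ∣ block i ∣ ≡ k
    pairs   : ∀ (x y : Fin v) → x ≢ y →
                Σ (Fin b) λ i → (x ∈ block i × y ∈ block i) ×
                  (∀ j → x ∈ block j → y ∈ block j → j ≡ i)

BlockIntersectionAdj : ∀ {v k} (D : BIBD₁ v k) →
  Fin (BIBD₁.b D) → Fin (BIBD₁.b D) → Set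
BlockIntersectionAdj {v} D i j =
  i ≢ j × ∃[ x ] (x ∈ BIBD₁.block D i × x ∈ BIBD₁.block D j)

module Game {a ℓ : Level} (V : Set a) (Adj : V → V → Set ℓ) where

  data Walk : V → V → ℕ → Set (a ⊔ ℓ) where
    here : ∀ {u} → Walk u u zero
    step : ∀ {u w t n} → Adj u w → Walk w t n → Walk u t (suc n)

  Dist : V → V → ℕ → Set (a ⊔ ℓ)
  Dist u w d = Walk u w d × (∀ n → Walk u w n → d ≤ n)

  Caught : ∀ {m} → (Fin m → V) → V → Set a
  Caught zs s = ∃[ i ] (zs i ≡ s)

  ZombieMove : ∀ {m} → (Fin m → V) → V → (Fin m → V) → Set (a ⊔ ℓ)
  ZombieMove zs s zs' = ∀ i → Adj (zs i) (zs' i) ×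
    ∃[ d ] ∃[ d' ] (Dist (zs i) s d × Dist (zs' i) s d' × d' < d)

  -- ZWin zs s : zombies at zs, survivor at s, zombies to move;
  -- the zombies can force a capture in finitely many rounds.
  data ZWin {m : ℕ} : (Fin m → V) → V → Set (a ⊔ ℓ) where
    caught : ∀ {zs s} → Caught zs s → ZWin zs s
    move   : ∀ {zs s} (zs' : Fin m → V) → ZombieMove zs s zs' →
             (Caught zs' s ⊎
               (∀ s' → (s' ≡ s ⊎ Adj s s') → ZWin zs' s')) →
             ZWin zs s

  ZombiesWin : ℕ → Set (a ⊔ ℓ)
  ZombiesWin m = ∃[ zs ] (∀ (s : V) → ZWin {m} zs s)

  ZombieNumber≤ : ℕ → Set (a ⊔ ℓ)
  ZombieNumber≤ k = ∃[ m ] (m ≤ k × ZombiesWin m)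

-- All zombies start on one block. The block intersection graph has diameter at most 2:
-- two disjoint blocks are joined by the line through a point of each. A zombie whose
-- block meets the survivor's block B steps onto B; otherwise zombie i steps onto the
-- line through a fixed point of its block and the i-th point of B. Either someone
-- captures at once, or afterwards the k zombies cover the k points of B. Wherever the
-- survivor goes, the new block shares a point with B, so a zombie's block meets it and
-- that zombie captures on the next move.
module Submission where

open import Defs
open import Data.Nat using (ℕ; zero; suc; _≤_; _<_; z≤n; s≤s)
open import Data.Nat.Properties using (≤-refl)
open import Data.Fin using (Fin; zero; suc)
open import Data.Fin.Properties using (any?; _≟_)
open import Data.Fin.Subset using (Subset; _∈_; ∣_∣; inside; outside)
open import Data.Fin.Subset.Properties using (_∈?_)
open import Data.Vec using ([]; _∷_; here; there)
open import Data.Product using (∃; ∃-syntax; _×_; _,_; proj₁; proj₂)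
open import Data.Sum using (_⊎_; inj₁; inj₂)
open import Data.Empty using (⊥-elim)
open import Level using (Level)
open import Relation.Nullary using (Dec; yes; no; ¬_)
open import Relation.Nullary.Decidable using (_×-dec_)
open import Relation.Binary.PropositionalEquality using (_≡_; _≢_; refl; sym; subst)

record Enumeration {n : ℕ} (p : Subset n) (k : ℕ) : Set where
  field
    elem  : Fin k → Fin n
    elem∈ : ∀ i → elem i ∈ p
    onto  : ∀ x → x ∈ p → ∃ λ i → elem i ≡ x

enumerate : ∀ {n} (p : Subset n) → Enumeration p ∣ p ∣
enumerate [] = record { elem = λ () ; elem∈ = λ () ; onto = λ _ () }
enumerate (outside ∷ p) = record
  { elem = λ i → suc (elem i) ; elem∈ = λ i → there (elem∈ i) ; onto = onto′ }
  where
  open Enumeration (enumerate p)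
  onto′ : ∀ x → x ∈ outside ∷ p → ∃ λ i → suc (elem i) ≡ x
  onto′ (suc x) (there x∈p) with onto x x∈p
  ... | i , refl = i , refl
enumerate (inside ∷ p) = record { elem = elem′ ; elem∈ = elem∈′ ; onto = onto′ }
  where
  open Enumeration (enumerate p)
  elem′ : Fin (suc ∣ p ∣) → Fin _
  elem′ zero    = zero
  elem′ (suc i) = suc (elem i)
  elem∈′ : ∀ i → elem′ i ∈ inside ∷ p
  elem∈′ zero    = here
  elem∈′ (suc i) = there (elem∈ i)
  onto′ : ∀ x → x ∈ inside ∷ p → ∃ λ i → elem′ i ≡ x
  onto′ zero    here        = zero , refl
  onto′ (suc x) (there x∈p) with onto x x∈p
  ... | i , refl = suc i , refl

module Distance {a ℓ : Level} {V : Set a} {Adj : V → V → Set ℓ} where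
  open Game V Adj

  LegalStep : V → V → V → Set _
  LegalStep z s z′ = Adj z z′ × ∃[ d ] ∃[ d′ ] (Dist z s d × Dist z′ s d′ × d′ < d)

  dist-refl : ∀ u → Dist u u 0
  dist-refl u = here , λ _ _ → z≤n

  dist-adj : ∀ {u w} → u ≢ w → Adj u w → Dist u w 1
  dist-adj {u} {w} u≢w uw = step uw here , shortest
    where
    shortest : ∀ n → Walk u w n → 1 ≤ n
    shortest zero    here = ⊥-elim (u≢w refl)
    shortest (suc n) _    = s≤s z≤n

  dist-two : ∀ {u c w} → u ≢ w → ¬ Adj u w → Adj u c → Adj c w → Dist u w 2
  dist-two {u} {w = w} u≢w ¬uw uc cw = step uc (step cw here) , shortest
    where
    shortest : ∀ n → Walk u w n → 2 ≤ n
    shortest zero          here             = ⊥-elim (u≢w refl)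
    shortest (suc zero)    (step uw here)   = ⊥-elim (¬uw uw)
    shortest (suc (suc n)) _                = s≤s (s≤s z≤n)

  legalStep : ∀ {z s z′ d} → Adj z z′ → Dist z s (suc d) → Dist z′ s d → LegalStep z s z′
  legalStep {d = d} zz′ dist dist′ = zz′ , suc d , d , dist , dist′ , ≤-refl

module BlockGraph {v k : ℕ} (D : BIBD₁ v (suc k)) where
  open BIBD₁ D
  open Game (Fin b) (BlockIntersectionAdj D)
  open Distance {V = Fin b} {Adj = BlockIntersectionAdj D}

  Meet : Fin b → Fin b → Set
  Meet B C = ∃[ x ] (x ∈ block B × x ∈ block C)

  meet? : ∀ B C → Dec (Meet B C)
  meet? B C = any? λ x → (x ∈? block B) ×-dec (x ∈? block C)

  points : ∀ B → Enumeration (block B) (suc k)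
  points B = subst (Enumeration (block B)) (size B) (enumerate (block B))

  point : Fin b → Fin (suc k) → Fin v
  point B = Enumeration.elem (points B)

  point∈ : ∀ B i → point B i ∈ block B
  point∈ B = Enumeration.elem∈ (points B)

  meet-refl : ∀ B → Meet B B
  meet-refl B = point B zero , point∈ B zero , point∈ B zero

  stay-or-adj-meets : ∀ {s s′} → s′ ≡ s ⊎ BlockIntersectionAdj D s s′ → Meet s s′
  stay-or-adj-meets (inj₁ refl)    = meet-refl _
  stay-or-adj-meets (inj₂ (_ , m)) = m

  module Detour {z s : Fin b} {x y : Fin v}
                (z∩s=∅ : ¬ Meet z s) (x∈z : x ∈ block z) (y∈s : y ∈ block s) where
    x≢y : x ≢ y
    x≢y refl = z∩s=∅ (x , x∈z , y∈s)

    line : Fin b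
    line = proj₁ (pairs x y x≢y)

    x∈line : x ∈ block line
    x∈line = proj₁ (proj₁ (proj₂ (pairs x y x≢y)))

    y∈line : y ∈ block line
    y∈line = proj₂ (proj₁ (proj₂ (pairs x y x≢y)))

    z~line : BlockIntersectionAdj D z line
    z~line = (λ z≡line → z∩s=∅ (y , subst (λ B → y ∈ block B) (sym z≡line) y∈line , y∈s))
           , x , x∈z , x∈line

    line~s : BlockIntersectionAdj D line s
    line~s = (λ line≡s → z∩s=∅ (x , x∈z , subst (λ B → x ∈ block B) line≡s x∈line))
           , y , y∈line , y∈s

    step-legal : LegalStep z s line
    step-legal = legalStep z~line
      (dist-two (λ { refl → z∩s=∅ (meet-refl z) }) (λ z~s → z∩s=∅ (proj₂ z~s)) z~line line~s)
      (dist-adj (proj₁ line~s) line~s)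

  chase : (z s : Fin b) → Dec (Meet z s) → Fin (suc k) → Fin b
  chase z s (yes _)    i = s
  chase z s (no z∩s=∅) i = Detour.line z∩s=∅ (point∈ z zero) (point∈ s i)

  chase-legal : ∀ {z s} → z ≢ s → (d : Dec (Meet z s)) → ∀ i → LegalStep z s (chase z s d i)
  chase-legal {s = s} z≢s (yes m)    i = legalStep (z≢s , m) (dist-adj z≢s (z≢s , m)) (dist-refl s)
  chase-legal         z≢s (no z∩s=∅) i = Detour.step-legal z∩s=∅ (point∈ _ zero) (point∈ _ i)

  chase-hits : ∀ {z s} → Meet z s → (d : Dec (Meet z s)) → ∀ i → chase z s d i ≡ s
  chase-hits m (yes _)    i = refl
  chase-hits m (no z∩s=∅) i = ⊥-elim (z∩s=∅ m)

  chase-covers : ∀ {z s} → ¬ Meet z s → (d : Dec (Meet z s)) → ∀ i → point s i ∈ block (chase z s d i)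
  chase-covers z∩s=∅ (yes m)     i = ⊥-elim (z∩s=∅ m)
  chase-covers _     (no z∩s=∅) i = Detour.y∈line z∩s=∅ (point∈ _ zero) (point∈ _ i)

  pursue : (Fin (suc k) → Fin b) → Fin b → Fin (suc k) → Fin b
  pursue zs s i = chase (zs i) s (meet? (zs i) s) i

  pursue-legal : ∀ {zs s} → (∀ i → zs i ≢ s) → ZombieMove zs s (pursue zs s)
  pursue-legal {zs} {s} uncaught i = chase-legal (uncaught i) (meet? (zs i) s) i

  covering-meets : ∀ (zs : Fin (suc k) → Fin b) {s s′} → (∀ i → point s i ∈ block (zs i)) → Meet s s′ →
                   ∃ λ i → Meet (zs i) s′
  covering-meets zs {s} covers (x , x∈s , x∈s′) with Enumeration.onto (points s) x x∈s
  ... | i , refl = i , x , covers i , x∈s′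

  capture : ∀ zs s j → Meet (zs j) s → ZWin zs s
  capture zs s j m with any? (λ i → zs i ≟ s)
  ... | yes c = caught c
  ... | no ¬c = move (pursue zs s) (pursue-legal λ i e → ¬c (i , e))
                     (inj₁ (j , chase-hits m (meet? (zs j) s) j))

  win : ∀ zs s → ZWin zs s
  win zs s with any? (λ i → zs i ≟ s)
  ... | yes c = caught c
  ... | no ¬c with any? (λ i → meet? (zs i) s)
  ...   | yes (j , m) = capture zs s j m
  ...   | no apart    = move (pursue zs s) (pursue-legal λ i e → ¬c (i , e)) (inj₂ next)
    where
    covers : ∀ i → point s i ∈ block (pursue zs s i)
    covers i = chase-covers (λ m → apart (i , m)) (meet? (zs i) s) i

    next : ∀ s′ → s′ ≡ s ⊎ BlockIntersectionAdj D s s′ → ZWin (pursue zs s) s′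
    next s′ s→s′ with covering-meets (pursue zs s) covers (stay-or-adj-meets s→s′)
    ... | i , m = capture (pursue zs s) s′ i m

  zombiesWin : Fin b → ZombiesWin (suc k)
  zombiesWin B = (λ _ → B) , win (λ _ → B)

someBlock : ∀ {v k} (D : BIBD₁ (suc (suc v)) k) → Fin (BIBD₁.b D)
someBlock D = proj₁ (BIBD₁.pairs D zero (suc zero) λ ())

mainTheorem5 : (v k : ℕ) → 2 ≤ k → k < v → (D : BIBD₁ v k) →
    Game.ZombieNumber≤ (Fin (BIBD₁.b D)) (BlockIntersectionAdj D) k
mainTheorem5 (suc (suc v)) (suc (suc k)) _ _ D =
  suc (suc k) , ≤-refl , BlockGraph.zombiesWin D (someBlock D)
mainTheorem5 zero          (suc (suc k)) _         ()        D
mainTheorem5 (suc zero)    (suc (suc k)) _         (s≤s ()) D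
mainTheorem5 _             zero          ()        _         D
mainTheorem5 _             (suc zero)    (s≤s ()) _         D
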